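{- For every two positive integers $d$ and $n$, $\nu_d(n) \le \lceil n/d \rceil$.
   Context: All graphs are finite, simple and undirected; $A_G$ is the adjacency matrix, $I$ the identity matrix, rank over $\mathbb{R}$, $\omega(G)$ the clique number. $\nu_d(n)$ is the minimum of $\operatorname{rank}(A_G+I)$ over all $n$-vertex graphs $G$ with $\omega(G)\le d$. -}

module Defs where

open import Data.Nat using (ℕ; zero; suc; _+_; _∸_; _≤_; NonZero)
open import Data.Nat.DivMod using (_/_)
open import Data.Fin using (Fin; zero; suc)
import Data.Fin
import Relation.Nullary
open import Data.Bool using (Bool; true; false)
open import Data.Product using (Σ; _×_; ∃-syntax)
open import Relation.Binary.PropositionalEquality using (_≡_; _≢_)
open import Data.Rational using (ℚ; 0ℚ; 1ℚ) renaming (_+_ to _+ℚ_; _*_ to _*ℚ_)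

record Graph (n : ℕ) : Set where
  field
    adj       : Fin n → Fin n → Bool
    symmetric : ∀ i j → adj i j ≡ adj j i
    loopless  : ∀ i → adj i i ≡ false
open Graph public

IsClique : ∀ {n} → Graph n → (k : ℕ) → (Fin k → Fin n) → Set
IsClique G k f = ∀ i j → i ≢ j → (f i ≢ f j) × (adj G (f i) (f j) ≡ true)

CliqueNumber≤ : ∀ {n} → Graph n → ℕ → Set
CliqueNumber≤ {n} G d = ∀ k (f : Fin k → Fin n) → IsClique G k f → k ≤ d

-- Real matrices are represented by rational ones: A_G + I has integer
-- entries, and the rank of a rational matrix is the same over ℚ and ℝ.
Matrix : ℕ → ℕ → Set
Matrix m n = Fin m → Fin n → ℚ

sumℚ : ∀ {k} → (Fin k → ℚ) → ℚ
sumℚ {zero}  f = 0ℚ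
sumℚ {suc k} f = f zero +ℚ sumℚ (λ i → f (suc i))

RowsIndependent : ∀ {m n k} → Matrix m n → (Fin k → Fin m) → Set
RowsIndependent {m} {n} {k} M sel =
  ∀ (c : Fin k → ℚ) →
    (∀ j → sumℚ (λ i → c i *ℚ M (sel i) j) ≡ 0ℚ) →
    ∀ i → c i ≡ 0ℚ

HasRank : ∀ {m n} → Matrix m n → ℕ → Set
HasRank {m} M r =
  Σ (Fin r → Fin m) (λ sel → RowsIndependent M sel) ×
  (∀ k (sel : Fin k → Fin m) → RowsIndependent M sel → k ≤ r)

adjPlusId : ∀ {n} → Graph n → Matrix n n
adjPlusId G i j with adj G i j | i Data.Fin.≟ j
... | true  | _ = 1ℚ
... | false | Relation.Nullary.yes _ = 1ℚ
... | false | Relation.Nullary.no  _ = 0ℚ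

⌈_/_⌉ : ℕ → (d : ℕ) → .{{NonZero d}} → ℕ
⌈ n / d ⌉ = (n + d ∸ 1) / d

-- Let G be the disjoint union of cliques on the consecutive blocks
-- {0, …, d-1}, {d, …, 2d-1}, … of the n vertices; there are ⌈n/d⌉ blocks.
-- A clique lies within one block, whose vertices have distinct residues
-- mod d, so ω(G) ≤ d.  The (i, j) entry of A_G + I is 1 exactly
-- when i and j share a block: rows within a block coincide, while the rows
-- of the first vertices of the blocks restrict to an identity matrix on the
-- same columns, so rank (A_G + I) = ⌈n/d⌉.
module Submission where

open import Defs
open import Data.Nat using (ℕ; _≤_; NonZero)
open import Data.Product using (Σ; _×_)

open import Data.Nat using (suc; _+_; _*_; _∸_; _<_; _≤?_; s≤s; z≤n)
open import Data.Nat.Properties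
  using (≤-refl; ≰⇒>; n<1+n; +-suc; +-comm; +-∸-assoc; m≤n+m; m+n∸n≡m;
         +-monoˡ-≤; ∸-monoˡ-≤; +-cancelˡ-≤; *-monoˡ-≤; module ≤-Reasoning)
open import Data.Nat.DivMod
  using (_/_; _%_; m≡m%n+[m/n]*n; m%n<n; m*n/n≡m; m/n*n≤m; /-monoˡ-≤; /-congˡ;
         m/n≡1+[m∸n]/n)
open import Data.Fin using (Fin; zero; suc; toℕ; fromℕ<)
open import Data.Fin.Properties
  using (_≟_; toℕ<n; toℕ-fromℕ<; toℕ-injective; fromℕ<-injective; pigeonhole; <⇒≢)
open import Data.Bool using (true; _∧_; not; if_then_else_)
open import Data.Bool.Properties using (∧-zeroʳ)
open import Data.Product using (_,_)
open import Data.Rational using (ℚ; 0ℚ; 1ℚ; -_; _-_) renaming (_+_ to _+ℚ_; _*_ to _*ℚ_)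
open import Data.Rational.Properties
  using (+-0-commutativeMonoid; *-identityʳ; *-zeroʳ; +-identityˡ; +-identityʳ; +-inverseʳ)
open import Data.Rational.Solver using (module +-*-Solver)
open import Algebra.Properties.CommutativeMonoid.Sum +-0-commutativeMonoid
  using (sum; sum-cong-≗; sum-replicate-zero; ∑-distrib-+)
open import Function using (_∘_; mk⇔)
open import Relation.Nullary using (¬_; does; yes; no)
open import Relation.Nullary.Decidable using (dec-true; dec-false; does-⇔)
open import Relation.Nullary.Negation using (contradiction)
open import Relation.Binary.PropositionalEquality

δ : ∀ {k} → Fin k → Fin k → ℚ
δ i j = if does (i ≟ j) then 1ℚ else 0ℚ

sumℚ≡sum : ∀ {k} (w : Fin k → ℚ) → sumℚ w ≡ sum w
sumℚ≡sum {0}     w = refl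
sumℚ≡sum {suc k}  w = cong (w zero +ℚ_) (sumℚ≡sum (w ∘ suc))

sumℚ-cong : ∀ {k} {v w : Fin k → ℚ} → (∀ i → v i ≡ w i) → sumℚ v ≡ sumℚ w
sumℚ-cong {v = v} {w} v≗w =
  trans (sumℚ≡sum v) (trans (sum-cong-≗ v≗w) (sym (sumℚ≡sum w)))

sumℚ-zero : ∀ {k} (w : Fin k → ℚ) → (∀ i → w i ≡ 0ℚ) → sumℚ w ≡ 0ℚ
sumℚ-zero {k} w w≗0 =
  trans (sumℚ≡sum w) (trans (sum-cong-≗ w≗0) (sum-replicate-zero k))

sumℚ-distrib-+ : ∀ {k} (v w : Fin k → ℚ) →
  sumℚ (λ i → v i +ℚ w i) ≡ sumℚ v +ℚ sumℚ w
sumℚ-distrib-+ v w = begin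
  sumℚ (λ i → v i +ℚ w i)  ≡⟨ sumℚ≡sum (λ i → v i +ℚ w i) ⟩
  sum (λ i → v i +ℚ w i)   ≡⟨ ∑-distrib-+ v w ⟩
  sum v +ℚ sum w           ≡⟨ sym (cong₂ _+ℚ_ (sumℚ≡sum v) (sumℚ≡sum w)) ⟩
  sumℚ v +ℚ sumℚ w         ∎
  where open ≡-Reasoning

sumℚ-δ : ∀ {k} (a : Fin k) (v : Fin k → ℚ) → sumℚ (λ i → v i *ℚ δ i a) ≡ v a
sumℚ-δ zero v = begin
  v zero *ℚ 1ℚ +ℚ sumℚ (λ i → v (suc i) *ℚ 0ℚ)
    ≡⟨ cong₂ _+ℚ_ (*-identityʳ (v zero))
                  (sumℚ-zero (λ i → v (suc i) *ℚ 0ℚ) (*-zeroʳ ∘ v ∘ suc)) ⟩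
  v zero +ℚ 0ℚ
    ≡⟨ +-identityʳ (v zero) ⟩
  v zero ∎
  where open ≡-Reasoning
sumℚ-δ (suc a) v = begin
  v zero *ℚ 0ℚ +ℚ sumℚ (λ i → v (suc i) *ℚ δ i a)
    ≡⟨ cong (_+ℚ sumℚ (λ i → v (suc i) *ℚ δ i a)) (*-zeroʳ (v zero)) ⟩
  0ℚ +ℚ sumℚ (λ i → v (suc i) *ℚ δ i a)
    ≡⟨ +-identityˡ (sumℚ (λ i → v (suc i) *ℚ δ i a)) ⟩
  sumℚ (λ i → v (suc i) *ℚ δ i a)
    ≡⟨ sumℚ-δ a (v ∘ suc) ⟩
  v (suc a) ∎
  where open ≡-Reasoning

δ-diag : ∀ {k} (i : Fin k) → δ i i ≡ 1ℚ
δ-diag i = cong (if_then 1ℚ else 0ℚ) (dec-true (i ≟ i) refl)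

δ-off : ∀ {k} {i j : Fin k} → i ≢ j → δ i j ≡ 0ℚ
δ-off {i = i} {j} i≢j = cong (if_then 1ℚ else 0ℚ) (dec-false (i ≟ j) i≢j)

unitMinor⇒rowsIndependent : ∀ {m n k} (M : Matrix m n) (sel : Fin k → Fin m)
  (col : Fin k → Fin n) → (∀ i j → M (sel i) (col j) ≡ δ i j) → RowsIndependent M sel
unitMinor⇒rowsIndependent M sel col unit c c·M≡0 j = begin
  c j
    ≡⟨ sym (sumℚ-δ j c) ⟩
  sumℚ (λ i → c i *ℚ δ i j)
    ≡⟨ sumℚ-cong (λ i → cong (c i *ℚ_) (sym (unit i j))) ⟩
  sumℚ (λ i → c i *ℚ M (sel i) (col j))
    ≡⟨ c·M≡0 (col j) ⟩
  0ℚ ∎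
  where open ≡-Reasoning

equalRows⇒¬rowsIndependent : ∀ {m n k} (M : Matrix m n) (sel : Fin k → Fin m)
  {a b : Fin k} → a ≢ b → (∀ j → M (sel a) j ≡ M (sel b) j) → ¬ RowsIndependent M sel
equalRows⇒¬rowsIndependent {k = k} M sel {a} {b} a≢b rowA≡rowB independent =
  1ℚ≢0ℚ (trans (sym c[a]≡1) (independent c c·M≡0 a))
  where
  open ≡-Reasoning
  open +-*-Solver using (solve; _:+_; _:*_; :-_; _:-_; _:=_)

  c : Fin k → ℚ
  c i = δ i a - δ i b

  c[a]≡1 : c a ≡ 1ℚ
  c[a]≡1 = cong₂ _-_ (δ-diag a) (δ-off a≢b)

  1ℚ≢0ℚ : 1ℚ ≢ 0ℚ
  1ℚ≢0ℚ ()

  expand : ∀ x y z → (x - y) *ℚ z ≡ z *ℚ x +ℚ (- z) *ℚ y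
  expand = solve 3 (λ x y z → (x :- y) :* z := z :* x :+ (:- z) :* y) refl

  c·M≡0 : ∀ j → sumℚ (λ i → c i *ℚ M (sel i) j) ≡ 0ℚ
  c·M≡0 j = begin
    sumℚ (λ i → c i *ℚ M (sel i) j)
      ≡⟨ sumℚ-cong (λ i → expand (δ i a) (δ i b) (M (sel i) j)) ⟩
    sumℚ (λ i → M (sel i) j *ℚ δ i a +ℚ (- M (sel i) j) *ℚ δ i b)
      ≡⟨ sumℚ-distrib-+ (λ i → M (sel i) j *ℚ δ i a) (λ i → (- M (sel i) j) *ℚ δ i b) ⟩
    sumℚ (λ i → M (sel i) j *ℚ δ i a) +ℚ sumℚ (λ i → (- M (sel i) j) *ℚ δ i b)
      ≡⟨ cong₂ _+ℚ_ (sumℚ-δ a (λ i → M (sel i) j)) (sumℚ-δ b (λ i → - M (sel i) j)) ⟩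
    M (sel a) j +ℚ - M (sel b) j
      ≡⟨ cong (λ x → M (sel a) j +ℚ - x) (sym (rowA≡rowB j)) ⟩
    M (sel a) j +ℚ - M (sel a) j
      ≡⟨ +-inverseʳ (M (sel a) j) ⟩
    0ℚ ∎

rowsIndependent⇒≤#rowClasses : ∀ {m n k r} (M : Matrix m n) (f : Fin m → Fin r) →
  (∀ {i i′} → f i ≡ f i′ → ∀ j → M i j ≡ M i′ j) →
  (sel : Fin k → Fin m) → RowsIndependent M sel → k ≤ r
rowsIndependent⇒≤#rowClasses {k = k} {r} M f rowsFactor sel independent with k ≤? r
... | yes k≤r = k≤r
... | no  k≰r with a , b , a<b , f[sel[a]]≡f[sel[b]] ← pigeonhole (≰⇒> k≰r) (f ∘ sel) =
  contradiction independent
    (equalRows⇒¬rowsIndependent M sel (<⇒≢ a<b) (rowsFactor f[sel[a]]≡f[sel[b]]))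

blockMatrix-hasRank : ∀ {m r} (M : Matrix m m) (f : Fin m → Fin r) (s : Fin r → Fin m) →
  (∀ b → f (s b) ≡ b) → (∀ i j → M i j ≡ δ (f i) (f j)) → HasRank M r
blockMatrix-hasRank M f s f∘s≗id M≡δ =
  (s , unitMinor⇒rowsIndependent M s s unit) ,
  (λ _ → rowsIndependent⇒≤#rowClasses M f rowsFactor)
  where
  unit : ∀ a b → M (s a) (s b) ≡ δ a b
  unit a b = trans (M≡δ (s a) (s b)) (cong₂ δ (f∘s≗id a) (f∘s≗id b))

  rowsFactor : ∀ {i i′} → f i ≡ f i′ → ∀ j → M i j ≡ M i′ j
  rowsFactor {i} {i′} f[i]≡f[i′] j =
    trans (M≡δ i j) (trans (cong (λ x → δ x (f j)) f[i]≡f[i′]) (sym (M≡δ i′ j)))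

blockGraph : ∀ {n r} → (Fin n → Fin r) → Graph n
blockGraph f = record
  { adj       = λ i j → does (f i ≟ f j) ∧ not (does (i ≟ j))
  ; symmetric = λ i j → cong₂ (λ x y → x ∧ not y) (does-sym (f i) (f j)) (does-sym i j)
  ; loopless  = λ i →
      trans (cong (λ y → does (f i ≟ f i) ∧ not y) (dec-true (i ≟ i) refl)) (∧-zeroʳ _)
  }
  where
  does-sym : ∀ {k} (x y : Fin k) → does (x ≟ y) ≡ does (y ≟ x)
  does-sym x y = does-⇔ (mk⇔ sym sym) (x ≟ y) (y ≟ x)

blockGraph-adj⇒sameBlock : ∀ {n r} (f : Fin n → Fin r) {i j} →
  adj (blockGraph f) i j ≡ true → f i ≡ f j
blockGraph-adj⇒sameBlock f {i} {j} with f i ≟ f j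
... | yes f[i]≡f[j] = λ _ → f[i]≡f[j]
... | no  _         = λ ()

adjPlusId-blockGraph : ∀ {n r} (f : Fin n → Fin r) i j →
  adjPlusId (blockGraph f) i j ≡ δ (f i) (f j)
adjPlusId-blockGraph f i j with f i ≟ f j | i ≟ j
... | yes _         | yes _    = refl
... | yes _         | no  _    = refl
... | no  _         | no  _    = refl
... | no  f[i]≢f[i] | yes refl = contradiction refl f[i]≢f[i]

blockGraph-cliqueNumber≤ : ∀ {n r d} (f : Fin n → Fin r) (g : Fin n → Fin d) →
  (∀ {i j} → f i ≡ f j → g i ≡ g j → i ≡ j) → CliqueNumber≤ (blockGraph f) d
blockGraph-cliqueNumber≤ {d = d} f g separates k h clique with k ≤? d
... | yes k≤d = k≤d
... | no  k≰d with x , y , x<y , g[h[x]]≡g[h[y]] ← pigeonhole (≰⇒> k≰d) (g ∘ h) =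
  let h[x]≢h[y] , adjacent = clique x y (<⇒≢ x<y)
      h[x]≡h[y]            = separates (blockGraph-adj⇒sameBlock f adjacent) g[h[x]]≡g[h[y]]
  in  contradiction h[x]≡h[y] h[x]≢h[y]

[m+n]/n≡1+m/n : ∀ m n .{{_ : NonZero n}} → (m + n) / n ≡ suc (m / n)
[m+n]/n≡1+m/n m n =
  trans (m/n≡1+[m∸n]/n (m≤n+m n m)) (cong (λ x → suc (x / n)) (m+n∸n≡m m n))

m<n⇒m/o<⌈n/o⌉ : ∀ {m n} o .{{_ : NonZero o}} → m < n → m / o < ⌈ n / o ⌉
m<n⇒m/o<⌈n/o⌉ {m} {n} o m<n = begin-strict
  m / o        <⟨ n<1+n (m / o) ⟩
  suc (m / o)  ≡⟨ sym ([m+n]/n≡1+m/n m o) ⟩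
  (m + o) / o  ≤⟨ /-monoˡ-≤ o (∸-monoˡ-≤ 1 (+-monoˡ-≤ o m<n)) ⟩
  ⌈ n / o ⌉    ∎
  where open ≤-Reasoning

m<⌈n/o⌉⇒m*o<n : ∀ {m n} o .{{_ : NonZero o}} → m < ⌈ n / o ⌉ → m * o < n
m<⌈n/o⌉⇒m*o<n {m} {n} o@(suc o′) m<⌈n/o⌉ = +-cancelˡ-≤ o′ (suc (m * o)) n (begin
  o′ + suc (m * o)  ≡⟨ +-suc o′ (m * o) ⟩
  suc m * o         ≤⟨ *-monoˡ-≤ o m<⌈n/o⌉ ⟩
  ⌈ n / o ⌉ * o     ≤⟨ m/n*n≤m (n + o ∸ 1) o ⟩
  n + o ∸ 1         ≡⟨ +-∸-assoc n (s≤s z≤n) ⟩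
  n + o′            ≡⟨ +-comm n o′ ⟩
  o′ + n            ∎)
  where open ≤-Reasoning

[/,%]-injective : ∀ {m n} o .{{_ : NonZero o}} → m / o ≡ n / o → m % o ≡ n % o → m ≡ n
[/,%]-injective {m} {n} o m/o≡n/o m%o≡n%o = begin
  m                  ≡⟨ m≡m%n+[m/n]*n m o ⟩
  m % o + m / o * o  ≡⟨ cong₂ (λ r q → r + q * o) m%o≡n%o m/o≡n/o ⟩
  n % o + n / o * o  ≡⟨ sym (m≡m%n+[m/n]*n n o) ⟩
  n                  ∎
  where open ≡-Reasoning

module ConsecutiveBlocks (n d : ℕ) .{{_ : NonZero d}} where

  blockOf : Fin n → Fin ⌈ n / d ⌉
  blockOf i = fromℕ< (m<n⇒m/o<⌈n/o⌉ d (toℕ<n i))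

  offset : Fin n → Fin d
  offset i = fromℕ< (m%n<n (toℕ i) d)

  blockStart : Fin ⌈ n / d ⌉ → Fin n
  blockStart b = fromℕ< (m<⌈n/o⌉⇒m*o<n d (toℕ<n b))

  blockOf-blockStart : ∀ b → blockOf (blockStart b) ≡ b
  blockOf-blockStart b = toℕ-injective (begin
    toℕ (blockOf (blockStart b))  ≡⟨ toℕ-fromℕ< _ ⟩
    toℕ (blockStart b) / d        ≡⟨ /-congˡ (toℕ-fromℕ< _) ⟩
    toℕ b * d / d                 ≡⟨ m*n/n≡m (toℕ b) d ⟩
    toℕ b                         ∎)
    where open ≡-Reasoning

  blockOf-offset-injective : ∀ {i j} → blockOf i ≡ blockOf j → offset i ≡ offset j → i ≡ j
  blockOf-offset-injective sameBlock sameOffset = toℕ-injective ([/,%]-injective d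
    (fromℕ<-injective _ _ _ _ sameBlock) (fromℕ<-injective _ _ _ _ sameOffset))

proposition2p18 : (d n : ℕ) → .{{_ : NonZero d}} → .{{_ : NonZero n}} →
    Σ (Graph n) (λ G → CliqueNumber≤ G d ×
      Σ ℕ (λ r → HasRank (adjPlusId G) r × r ≤ ⌈ n / d ⌉))
proposition2p18 d n =
  blockGraph blockOf ,
  blockGraph-cliqueNumber≤ blockOf offset blockOf-offset-injective ,
  ⌈ n / d ⌉ ,
  blockMatrix-hasRank (adjPlusId (blockGraph blockOf)) blockOf blockStart
    blockOf-blockStart (adjPlusId-blockGraph blockOf) ,
  ≤-refl
  where open ConsecutiveBlocks n d
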